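{- An $(n,m)$-voltage operator $(\mathcal{Y},\eta)$ preserves connectivity if and only if $\mathcal{Y}$ is connected and $\eta(\Pi^{y_0}(\mathcal{Y}))=\mathrm{Mon}(\mathcal{U}^n)$ for some vertex $y_0$ of $\mathcal{Y}$.
   Context: Graphs may have semiedges and parallel edges. An $n$-premaniplex is a graph whose darts are colored by $\{0,\dots,n-1\}$ (a dart and its inverse have the same color) such that every vertex is the starting point of exactly one dart of each color, and for $|i-j|\ge 2$ every path of length 4 alternating colors $i,j$ is closed. For a vertex $x$, ${}^i x$ denotes the dart of color $i$ starting at $x$, and $x^i$ its endpoint. The group $\mathrm{Mon}(\mathcal U^n)=\langle r_0,\dots,r_{n-1}\mid r_i^2=1,\ (r_ir_j)^2=1 \text{ for } |i-j|\ge2\rangle$ acts on the left on the vertex set of every $n$-premaniplex by $r_i x=x^i$. A voltage assignment $\eta$ with group $G$ assigns $\eta(d)\in G$ to each dart $d$ with $\eta(d^{ -1})=\eta(d)^{ -1}$; the voltage of a path $d_1\cdots d_k$ is $\eta(d_k)\cdots\eta(d_1)$. Paths are considered up to maniplex homotopy (inserting/deleting two consecutive darts of the same color, or swapping two consecutive colors $i,j$ with $|i-j|\ge2$); $\Pi^{y}(\mathcal Y)$ denotes the group of homotopy classes of closed paths based at $y$. An $(n,m)$-voltage operator is a pair $(\mathcal Y,\eta)$ with $\mathcal Y$ an $m$-premaniplex and $\eta$ a voltage assignment with group $\mathrm{Mon}(\mathcal U^n)$ such that every length-4 path alternating between colors $i,j$ with $|i-j|\ge2$ has trivial voltage. For an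 $n$-premaniplex $\mathcal X$, $\mathcal X\rtimes_\eta\mathcal Y$ is the $m$-edge-colored graph on $V(\mathcal X)\times V(\mathcal Y)$ where for each color $i$ there is an edge of color $i$ joining $(x,y)$ and $(\eta({}^i y)x,\ y^i)$. The operator $(\mathcal Y,\eta)$ preserves connectivity if $\mathcal X\rtimes_\eta\mathcal Y$ is connected for every connected $n$-premaniplex $\mathcal X$. -}

module Defs where

open import Data.Nat using (ℕ; _≤_; ∣_-_∣)
open import Data.Fin using (Fin; toℕ)
open import Data.List using (List; []; _∷_; _++_; reverse)
open import Data.Product using (Σ; _×_; _,_)
open import Relation.Binary.PropositionalEquality using (_≡_)

Far : ∀ {n} → Fin n → Fin n → Set
Far i j = 2 ≤ ∣ toℕ i - toℕ j ∣

-- Mon(U^n) = ⟨ r_0..r_{n-1} | r_i² , (r_i r_j)² for |i-j| ≥ 2 ⟩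
-- Elements are words in the generators (the list i₁ ∷ … ∷ i_k stands for
-- r_{i₁} ⋯ r_{i_k}), modulo the congruence generated by the relations.
-- Since each r_i is an involution, (r_i r_j)² = 1 is equivalent to
-- r_i r_j = r_j r_i.

Word : ℕ → Set
Word n = List (Fin n)

infix 4 _≈w_
data _≈w_ {n : ℕ} : Word n → Word n → Set where
  ≈refl  : ∀ {u} → u ≈w u
  ≈sym   : ∀ {u v} → u ≈w v → v ≈w u
  ≈trans : ∀ {u v w} → u ≈w v → v ≈w w → u ≈w w
  cancel : ∀ (u v : Word n) (i : Fin n) → (u ++ i ∷ i ∷ v) ≈w (u ++ v)
  swap   : ∀ (u v : Word n) (i j : Fin n) → Far i j →
           (u ++ i ∷ j ∷ v) ≈w (u ++ j ∷ i ∷ v)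

-- inverse of a word (generators are involutions)
winv : ∀ {n} → Word n → Word n
winv = reverse

-- Edge-colored graphs in which every vertex is the start of exactly one
-- dart of each color: the dart ^i x is identified with the pair (x , i),
-- and step i x = x^i is its endpoint.  (Semiedges: step i x ≡ x.)

record ColoredGraph (k : ℕ) : Set₁ where
  field
    V    : Set
    step : Fin k → V → V

module _ {k : ℕ} (G : ColoredGraph k) where
  open ColoredGraph G

  walk : List (Fin k) → V → V
  walk []       x = x
  walk (c ∷ cs) x = walk cs (step c x)

  Connected : Set
  Connected = Σ V (λ _ → V) × ((a b : V) → Σ (List (Fin k)) (λ cs → walk cs a ≡ b))

record Premaniplex (n : ℕ) : Set₁ where
  field
    graph : ColoredGraph n
  open ColoredGraph graph public
  field
    invol : ∀ (i : Fin n) (x : V) → step i (step i x) ≡ x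
    comm  : ∀ (i j : Fin n) → Far i j → ∀ (x : V) →
            step j (step i (step j (step i x))) ≡ x

open Premaniplex public using (graph)

act : ∀ {n} (X : Premaniplex n) → Word n → Premaniplex.V X → Premaniplex.V X
act X []      x = x
act X (i ∷ w) x = Premaniplex.step X i (act X w x)

module _ {n m : ℕ} (Y : Premaniplex m) (η : Premaniplex.V Y → Fin m → Word n) where
  open Premaniplex Y

  -- voltage of the path d₁⋯d_l (colors cs, starting at y) is η(d_l)⋯η(d₁)
  pathVoltage : List (Fin m) → V → Word n
  pathVoltage []       y = []
  pathVoltage (c ∷ cs) y = pathVoltage cs (step c y) ++ η y c

record VoltageOperator (n m : ℕ) : Set₁ where
  field
    Y   : Premaniplex m
    η   : Premaniplex.V Y → Fin m → Word n
    -- η(d⁻¹) = η(d)⁻¹ ; the inverse of the dart (y , i) is (y^i , i)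
    η-inv  : ∀ (y : Premaniplex.V Y) (i : Fin m) →
             η (Premaniplex.step Y i y) i ≈w winv (η y i)
    η-comm : ∀ (i j : Fin m) → Far i j → ∀ (y : Premaniplex.V Y) →
             pathVoltage Y η (i ∷ j ∷ i ∷ j ∷ []) y ≈w []

_⋊_ : ∀ {n m} → Premaniplex n → VoltageOperator n m → ColoredGraph m
X ⋊ O = record
  { V    = Premaniplex.V X × Premaniplex.V Y
  ; step = λ i p → act X (η (proj₂' p) i) (proj₁' p) , Premaniplex.step Y i (proj₂' p)
  }
  where
    open VoltageOperator O
    proj₁' : ∀ {A B : Set} → A × B → A
    proj₁' (a , _) = a
    proj₂' : ∀ {A B : Set} → A × B → B
    proj₂' (_ , b) = b

PreservesConnectivity : ∀ {n m} → VoltageOperator n m → Set₁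
PreservesConnectivity {n} O =
  (X : Premaniplex n) → Connected (graph X) → Connected (X ⋊ O)

-- η(Π^{y₀}(Y)) = Mon(U^n): every element of Mon(U^n) is the voltage of
-- some closed path based at y₀ (the voltage of a homotopy class is that of
-- any representative, so the image is the set of voltages of closed paths).
VoltageImageIsMon : ∀ {n m} (O : VoltageOperator n m) →
                    Premaniplex.V (VoltageOperator.Y O) → Set
VoltageImageIsMon {n} {m} O y₀ =
  (g : Word n) → Σ (List (Fin m)) (λ cs →
     (walk (graph Y) cs y₀ ≡ y₀) × (pathVoltage Y η cs y₀ ≈w g))
  where open VoltageOperator O

{-# OPTIONS --safe #-}
-- Walks in X ⋊ Y are walks in Y whose voltage acts on the X-coordinate. If Y is connected and
-- closed walks at y₀ realise every element of Mon(Uⁿ), two vertices of X ⋊ Y are joined by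
-- walking into the fibre over y₀, moving inside it along closed walks whose voltages follow a
-- walk of X, and walking out again. Conversely, take for X the universal premaniplex Uⁿ (the
-- Cayley graph of Mon(Uⁿ)): it is connected and Mon(Uⁿ) acts freely on it, so a walk from
-- (1, y₀) to (g, y₀) in Uⁿ ⋊ Y is a closed walk at y₀ of voltage g. Building Uⁿ with
-- propositional equality needs a normal form for the right-angled Coxeter group Mon(Uⁿ); it
-- comes from heaps of pieces, r_i being a domino on the columns i and i+1.
module Submission where

open import Defs
open import Axiom.UniquenessOfIdentityProofs.WithK using (uip)
open import Data.Bool using (Bool; true; false; not; if_then_else_) renaming (_≟_ to _≟ᵇ_)
open import Data.Bool.Properties using (¬-not; not-injective)
open import Data.Empty using (⊥-elim)
open import Data.Fin using (Fin; zero; suc; toℕ; _≟_)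
open import Data.Fin.Properties using (any?)
open import Data.List using (List; []; _∷_; _++_; reverse; length; [_])
open import Data.List.Properties using (++-assoc; unfold-reverse; reverse-involutive)
open import Data.Nat using (ℕ; zero; suc; _<_; s≤s; z≤n; _≤?_; ∣_-_∣)
open import Data.Nat.Properties using (≤-refl; <-trans; <-≤-trans; n≤1+n; m<n⇒m<1+n; +-monoʳ-≤; +-monoʳ-<)
open import Data.Product using (Σ; _×_; _,_; proj₁; proj₂)
open import Data.Vec using (Vec; _∷_; replicate; map; sum)
open import Function using (_∘_)
open import Function.Bundles using (_⇔_; mk⇔)
open import Relation.Nullary using (¬_; yes; no)
open import Relation.Binary.PropositionalEquality
  using (_≡_; refl; sym; trans; cong; cong₂; subst; subst₂; _≢_; module ≡-Reasoning)

++-congˡ : ∀ {n} (p : Word n) {u w : Word n} → u ≈w w → p ++ u ≈w p ++ w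
++-congˡ p ≈refl = ≈refl
++-congˡ p (≈sym q) = ≈sym (++-congˡ p q)
++-congˡ p (≈trans q r) = ≈trans (++-congˡ p q) (++-congˡ p r)
++-congˡ p (cancel u v i) =
  subst₂ _≈w_ (++-assoc p u (i ∷ i ∷ v)) (++-assoc p u v) (cancel (p ++ u) v i)
++-congˡ p (swap u v i j f) =
  subst₂ _≈w_ (++-assoc p u (i ∷ j ∷ v)) (++-assoc p u (j ∷ i ∷ v)) (swap (p ++ u) v i j f)

∷-congˡ : ∀ {n} (i : Fin n) {u w : Word n} → u ≈w w → i ∷ u ≈w i ∷ w
∷-congˡ i = ++-congˡ [ i ]

walk-++ : ∀ {k} (G : ColoredGraph k) (u v : List (Fin k)) x →
          walk G (u ++ v) x ≡ walk G v (walk G u x)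
walk-++ G []      v x = refl
walk-++ G (c ∷ u) v x = walk-++ G u v _

Reachable : ∀ {k} (G : ColoredGraph k) → ColoredGraph.V G → ColoredGraph.V G → Set
Reachable {k} G a b = Σ (List (Fin k)) λ cs → walk G cs a ≡ b

Reachable-trans : ∀ {k} (G : ColoredGraph k) {a b c} → Reachable G a b → Reachable G b c → Reachable G a c
Reachable-trans G (u , refl) (v , refl) = u ++ v , walk-++ G u v _

module _ {n : ℕ} (X : Premaniplex n) where
  open Premaniplex X using (V; step; invol; comm)
  open ≡-Reasoning

  act-++ : ∀ (u v : Word n) x → act X (u ++ v) x ≡ act X u (act X v x)
  act-++ []      v x = refl
  act-++ (i ∷ u) v x = cong (step i) (act-++ u v x)

  step-comm : ∀ i j → Far i j → ∀ x → step i (step j x) ≡ step j (step i x)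
  step-comm i j f x = begin
    step i (step j x)                                     ≡⟨ sym (comm i j f (step i (step j x))) ⟩
    step j (step i (step j (step i (step i (step j x))))) ≡⟨ cong (step j ∘ step i ∘ step j) (invol i (step j x)) ⟩
    step j (step i (step j (step j x)))                   ≡⟨ cong (step j ∘ step i) (invol j x) ⟩
    step j (step i x)                                     ∎

  act-cong : ∀ {u w : Word n} → u ≈w w → ∀ x → act X u x ≡ act X w x
  act-cong ≈refl x = refl
  act-cong (≈sym q) x = sym (act-cong q x)
  act-cong (≈trans q r) x = trans (act-cong q x) (act-cong r x)
  act-cong (cancel u v i) x = begin
    act X (u ++ i ∷ i ∷ v) x              ≡⟨ act-++ u (i ∷ i ∷ v) x ⟩
    act X u (step i (step i (act X v x))) ≡⟨ cong (act X u) (invol i (act X v x)) ⟩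
    act X u (act X v x)                   ≡⟨ act-++ u v x ⟨
    act X (u ++ v) x                      ∎
  act-cong (swap u v i j f) x = begin
    act X (u ++ i ∷ j ∷ v) x              ≡⟨ act-++ u (i ∷ j ∷ v) x ⟩
    act X u (step i (step j (act X v x))) ≡⟨ cong (act X u) (step-comm i j f (act X v x)) ⟩
    act X u (step j (step i (act X v x))) ≡⟨ act-++ u (j ∷ i ∷ v) x ⟨
    act X (u ++ j ∷ i ∷ v) x              ∎

  act-winvˡ : ∀ (w : Word n) x → act X (winv w) (act X w x) ≡ x
  act-winvˡ []      x = refl
  act-winvˡ (i ∷ w) x = begin
    act X (reverse (i ∷ w)) (step i (act X w x))    ≡⟨ cong (λ u → act X u (step i (act X w x))) (unfold-reverse i w) ⟩
    act X (reverse w ++ [ i ]) (step i (act X w x)) ≡⟨ act-++ (reverse w) [ i ] _ ⟩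
    act X (reverse w) (step i (step i (act X w x))) ≡⟨ cong (act X (reverse w)) (invol i (act X w x)) ⟩
    act X (reverse w) (act X w x)                   ≡⟨ act-winvˡ w x ⟩
    x                                               ∎

  act-winvʳ : ∀ (w : Word n) x → act X w (act X (winv w) x) ≡ x
  act-winvʳ w x =
    subst (λ u → act X u (act X (winv w) x) ≡ x) (reverse-involutive w) (act-winvˡ (winv w) x)

  walk≡act-reverse : ∀ (cs : Word n) x → walk (graph X) cs x ≡ act X (reverse cs) x
  walk≡act-reverse []       x = refl
  walk≡act-reverse (c ∷ cs) x = begin
    walk (graph X) cs (step c x)  ≡⟨ walk≡act-reverse cs (step c x) ⟩
    act X (reverse cs) (step c x) ≡⟨ act-++ (reverse cs) [ c ] x ⟨
    act X (reverse cs ++ [ c ]) x ≡⟨ cong (λ u → act X u x) (unfold-reverse c cs) ⟨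
    act X (reverse (c ∷ cs)) x    ∎

  reachable-act : ∀ (w : Word n) x → Reachable (graph X) x (act X w x)
  reachable-act w x = reverse w , (begin
    walk (graph X) (reverse w) x  ≡⟨ walk≡act-reverse (reverse w) x ⟩
    act X (reverse (reverse w)) x ≡⟨ cong (λ u → act X u x) (reverse-involutive w) ⟩
    act X w x                     ∎)

  transitive⇒connected : (x₀ : V) → (∀ x → Σ (Word n) λ w → act X w x₀ ≡ x) → Connected (graph X)
  transitive⇒connected x₀ orbit = (x₀ , x₀) , path
    where
    path : ∀ a b → Reachable (graph X) a b
    path a b with orbit a | orbit b
    ... | u , refl | v , refl = Reachable-trans (graph X)
      (subst (Reachable (graph X) a) (act-winvˡ u x₀) (reachable-act (winv u) a))
      (reachable-act v x₀)

  FreeAt : V → Set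
  FreeAt x₀ = ∀ u w → act X u x₀ ≡ act X w x₀ → u ≈w w

-- A piece r_i is stored as true on column i and false on column i+1. onTop decides whether two
-- columns end in a common r_i piece; counting such pairs modulo 2 makes toggle an involution on
-- all pairs of columns, not only on those occurring in heaps of words.
Column : Set
Column = List Bool

onTop : Column × Column → Bool
onTop (true ∷ a , false ∷ b) = not (onTop (a , b))
onTop _                      = false

place : Column × Column → Column × Column
place (a , b) = true ∷ a , false ∷ b

remove : Column × Column → Column × Column
remove (_ ∷ a , _ ∷ b) = a , b
remove p               = p

toggle : Column × Column → Column × Column
toggle p = if onTop p then remove p else place p

toggle-involutive : ∀ p → toggle (toggle p) ≡ p
toggle-involutive (true ∷ a , false ∷ b) with onTop (a , b) in e
... | true  rewrite e = refl
... | false rewrite e = refl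
toggle-involutive ([] , _)              = refl
toggle-involutive (false ∷ _ , _)       = refl
toggle-involutive (true ∷ _ , [])       = refl
toggle-involutive (true ∷ _ , true ∷ _) = refl

onTop-toggle : ∀ p → onTop (toggle p) ≡ not (onTop p)
onTop-toggle (true ∷ a , false ∷ b) with onTop (a , b) in e
... | true  rewrite e = refl
... | false rewrite e = refl
onTop-toggle ([] , _)              = refl
onTop-toggle (false ∷ _ , _)       = refl
onTop-toggle (true ∷ _ , [])       = refl
onTop-toggle (true ∷ _ , true ∷ _) = refl

onTop-right-true : ∀ a b → onTop (a , true ∷ b) ≡ false
onTop-right-true []          _ = refl
onTop-right-true (true ∷ _)  _ = refl
onTop-right-true (false ∷ _) _ = refl

Stacks : ℕ → Set
Stacks n = Vec Column (suc n)

infixr 5 _∷²_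
_∷²_ : ∀ {k} → Column × Column → Vec Column k → Vec Column (suc (suc k))
(a , b) ∷² s = a ∷ b ∷ s

toggleAt : ∀ {n} → Fin n → Stacks n → Stacks n
toggleAt zero    (a ∷ b ∷ s) = toggle (a , b) ∷² s
toggleAt (suc i) (a ∷ s)     = a ∷ toggleAt i s

removable : ∀ {n} → Fin n → Stacks n → Bool
removable zero    (a ∷ b ∷ _) = onTop (a , b)
removable (suc i) (_ ∷ s)     = removable i s

size : ∀ {k} → Vec Column k → ℕ
size s = sum (map length s)

toggleAt-involutive : ∀ {n} (i : Fin n) s → toggleAt i (toggleAt i s) ≡ s
toggleAt-involutive zero    (a ∷ b ∷ s) = cong (_∷² s) (toggle-involutive (a , b))
toggleAt-involutive (suc i) (a ∷ s)     = cong (a ∷_) (toggleAt-involutive i s)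

toggleAt-comm : ∀ {n} (i j : Fin n) → Far i j → ∀ s → toggleAt i (toggleAt j s) ≡ toggleAt j (toggleAt i s)
toggleAt-comm zero          zero          ()
toggleAt-comm zero          (suc zero)    (s≤s ())
toggleAt-comm (suc zero)    zero          (s≤s ())
toggleAt-comm zero          (suc (suc j)) _ (a ∷ b ∷ s) = refl
toggleAt-comm (suc (suc i)) zero          _ (a ∷ b ∷ s) = refl
toggleAt-comm (suc i)       (suc j)       f (a ∷ s)     = cong (a ∷_) (toggleAt-comm i j f s)

removable-toggleAt-far : ∀ {n} (i j : Fin n) → Far i j → ∀ s → removable i (toggleAt j s) ≡ removable i s
removable-toggleAt-far zero          zero          ()
removable-toggleAt-far zero          (suc zero)    (s≤s ())
removable-toggleAt-far (suc zero)    zero          (s≤s ())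
removable-toggleAt-far zero          (suc (suc j)) _ (a ∷ b ∷ s) = refl
removable-toggleAt-far (suc (suc i)) zero          _ (a ∷ b ∷ s) = refl
removable-toggleAt-far (suc i)       (suc j)       f (a ∷ s)     = removable-toggleAt-far i j f s

removable-toggleAt-self : ∀ {n} (i : Fin n) s → removable i (toggleAt i s) ≡ not (removable i s)
removable-toggleAt-self zero    (a ∷ b ∷ s) = onTop-toggle (a , b)
removable-toggleAt-self (suc i) (a ∷ s)     = removable-toggleAt-self i s

removable-toggleAt-adjacent : ∀ {n} (i j : Fin n) → i ≢ j → ¬ Far i j → ∀ s →
                              removable i (toggleAt j s) ≡ true → removable j s ≡ true
removable-toggleAt-adjacent zero (suc zero) _ _ (a ∷ b ∷ c ∷ s) r with onTop (b , c) in e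
... | true  = refl
... | false with () ← trans (sym (onTop-right-true a b)) r
removable-toggleAt-adjacent (suc zero) zero _ _ (a ∷ b ∷ c ∷ s) r with onTop (a , b) in e
... | true  = refl
... | false with () ← r
removable-toggleAt-adjacent (suc i) (suc j) i≢j near (a ∷ s) r =
  removable-toggleAt-adjacent i j (i≢j ∘ cong suc) near s r
removable-toggleAt-adjacent zero zero i≢j _ _ _ = ⊥-elim (i≢j refl)
removable-toggleAt-adjacent zero (suc (suc j)) _ near _ _ = ⊥-elim (near (s≤s (s≤s z≤n)))
removable-toggleAt-adjacent (suc (suc i)) zero _ near _ _ = ⊥-elim (near (s≤s (s≤s z≤n)))

size-toggleAt : ∀ {n} (i : Fin n) s → removable i s ≡ true → size (toggleAt i s) < size s
size-toggleAt zero ((true ∷ a) ∷ (false ∷ b) ∷ s) e with onTop (a , b)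
... | false = s≤s (+-monoʳ-≤ (length a) (n≤1+n _))
... | true with () ← e
size-toggleAt zero ([] ∷ _ ∷ _) ()
size-toggleAt zero ((false ∷ _) ∷ _ ∷ _) ()
size-toggleAt zero ((true ∷ _) ∷ [] ∷ _) ()
size-toggleAt zero ((true ∷ _) ∷ (true ∷ _) ∷ _) ()
size-toggleAt (suc i) (a ∷ s) e = +-monoʳ-< (length a) (size-toggleAt i s e)

removable-empty : ∀ {n} (i : Fin n) → removable i (replicate (suc n) []) ≡ false
removable-empty zero    = refl
removable-empty (suc i) = removable-empty i

heapPremaniplex : (n : ℕ) → Premaniplex n
heapPremaniplex n = record
  { graph = record { V = Stacks n ; step = toggleAt }
  ; invol = toggleAt-involutive
  ; comm  = alternating
  }
  where
  alternating : ∀ i j → Far i j → ∀ s → toggleAt j (toggleAt i (toggleAt j (toggleAt i s))) ≡ s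
  alternating i j f s = begin
    toggleAt j (toggleAt i (toggleAt j (toggleAt i s))) ≡⟨ cong (toggleAt j) (toggleAt-comm i j f (toggleAt i s)) ⟩
    toggleAt j (toggleAt j (toggleAt i (toggleAt i s))) ≡⟨ toggleAt-involutive j _ ⟩
    toggleAt i (toggleAt i s)                           ≡⟨ toggleAt-involutive i s ⟩
    s                                                   ∎
    where open ≡-Reasoning

module _ {n : ℕ} where

  empty : Stacks n
  empty = replicate _ []

  heap : Word n → Stacks n
  heap w = act (heapPremaniplex n) w empty

  heap-cong : ∀ {u w : Word n} → u ≈w w → heap u ≡ heap w
  heap-cong e = act-cong (heapPremaniplex n) e empty

  heap-≈∷ : ∀ {v v′ : Word n} {i} → v ≈w i ∷ v′ → heap v′ ≡ toggleAt i (heap v)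
  heap-≈∷ {v} {v′} {i} e = begin
    heap v′                    ≡⟨ toggleAt-involutive i (heap v′) ⟨
    toggleAt i (heap (i ∷ v′)) ≡⟨ cong (toggleAt i) (heap-cong e) ⟨
    toggleAt i (heap v)        ∎
    where open ≡-Reasoning

  LeftFactor : Word n → Fin n → Set
  LeftFactor v i = Σ (Word n) λ v′ → length v′ < length v × v ≈w i ∷ v′

  removable⇒leftFactor : ∀ k v i → length v < k → removable i (heap v) ≡ true → LeftFactor v i
  removable⇒leftFactor (suc k) []      i _ r with () ← trans (sym (removable-empty i)) r
  removable⇒leftFactor (suc k) (j ∷ v) i (s≤s l) r with i ≟ j | 2 ≤? ∣ toℕ i - toℕ j ∣
  ... | yes refl | _ = v , ≤-refl , ≈refl
  ... | no i≢j | yes far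
    with v′ , l′ , e′ ← removable⇒leftFactor k v i l (trans (sym (removable-toggleAt-far i j far (heap v))) r)
    = j ∷ v′ , s≤s l′ , ≈trans (∷-congˡ j e′) (≈sym (swap [] v′ i j far))
  ... | no i≢j | no near
    -- toggling r_j onto the heap of v would cover r_i, so it removed an r_j piece: v ≈ j ∷ v₁
    with v₁ , l₁ , e₁ ← removable⇒leftFactor k v j l (removable-toggleAt-adjacent i j i≢j near (heap v) r)
    with v₂ , l₂ , e₂ ← removable⇒leftFactor k v₁ i (<-trans l₁ l) (trans (cong (removable i) (heap-≈∷ e₁)) r)
    = v₂ , <-trans l₂ (m<n⇒m<1+n l₁) , ≈trans (∷-congˡ j e₁) (≈trans (cancel [] v₁ j) e₂)

  irreducible⇒≈[] : ∀ k w → length w < k → (∀ j → removable j (heap w) ≡ false) → w ≈w []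
  irreducible⇒≈[] (suc k) []      _       _    = ≈refl
  irreducible⇒≈[] (suc k) (j ∷ w) (s≤s l) none
    with w′ , l′ , e′ ← removable⇒leftFactor k w j l
                                 (not-injective (trans (sym (removable-toggleAt-self j (heap w))) (none j)))
    = ≈trans (∷-congˡ j e′) (≈trans (cancel [] w′ j)
        (irreducible⇒≈[] k w′ (<-trans l′ l) (λ i → trans (cong (removable i) (heap-≈∷ e′)) (none i))))

  readBack : ℕ → Stacks n → Word n
  readBack zero    s = []
  readBack (suc k) s with any? (λ i → removable i s ≟ᵇ true)
  ... | yes (i , _) = i ∷ readBack k (toggleAt i s)
  ... | no _        = []

  normalForm : Stacks n → Word n
  normalForm s = readBack (suc (size s)) s

  readBack-heap : ∀ k w → size (heap w) < k → readBack k (heap w) ≈w w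
  readBack-heap (suc k) w (s≤s h) with any? (λ i → removable i (heap w) ≟ᵇ true)
  ... | no none = ≈sym (irreducible⇒≈[] _ w ≤-refl λ j → ¬-not (λ r → none (j , r)))
  ... | yes (i , r) with w′ , _ , e ← removable⇒leftFactor _ w i ≤-refl r
    = ≈trans (∷-congˡ i (subst (λ s → readBack k s ≈w w′) (heap-≈∷ e) (readBack-heap k w′ shrunk)))
             (≈sym e)
    where
    shrunk : size (heap w′) < k
    shrunk = subst (λ s → size s < k) (sym (heap-≈∷ e)) (<-≤-trans (size-toggleAt i (heap w) r) h)

  normalForm-heap : ∀ w → normalForm (heap w) ≈w w
  normalForm-heap w = readBack-heap _ w ≤-refl

  heap-injective : ∀ {u w} → heap u ≡ heap w → u ≈w w
  heap-injective {u} {w} e =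
    ≈trans (≈sym (normalForm-heap u)) (subst (λ s → normalForm s ≈w w) (sym e) (normalForm-heap w))

  -- Unlike ∃ λ w → heap w ≡ s, this is a proposition, as the premaniplex laws on Reduced need.
  Reduced : Set
  Reduced = Σ (Stacks n) λ s → heap (normalForm s) ≡ s

  reduced-≡ : ∀ {x y : Reduced} → proj₁ x ≡ proj₁ y → x ≡ y
  reduced-≡ {s , p} {.s , q} refl = cong (s ,_) (uip p q)

  toggleReduced : Fin n → Reduced → Reduced
  toggleReduced i (s , p) = toggleAt i s , (begin
    heap (normalForm (toggleAt i s))            ≡⟨ cong (heap ∘ normalForm ∘ toggleAt i) p ⟨
    heap (normalForm (heap (i ∷ normalForm s))) ≡⟨ heap-cong (normalForm-heap (i ∷ normalForm s)) ⟩
    heap (i ∷ normalForm s)                     ≡⟨ cong (toggleAt i) p ⟩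
    toggleAt i s                                ∎)
    where open ≡-Reasoning

  universal : Premaniplex n
  universal = record
    { graph = record { V = Reduced ; step = toggleReduced }
    ; invol = λ i x → reduced-≡ (toggleAt-involutive i (proj₁ x))
    ; comm  = λ i j f x → reduced-≡ (Premaniplex.comm (heapPremaniplex n) i j f (proj₁ x))
    }

  base : Reduced
  base = empty , heap-cong (normalForm-heap [])

  proj₁-act-universal : ∀ u (x : Reduced) → proj₁ (act universal u x) ≡ act (heapPremaniplex n) u (proj₁ x)
  proj₁-act-universal []      x = refl
  proj₁-act-universal (i ∷ u) x = cong (toggleAt i) (proj₁-act-universal u x)

  universal-connected : Connected (graph universal)
  universal-connected = transitive⇒connected universal base λ (s , p) →
    normalForm s , reduced-≡ (trans (proj₁-act-universal (normalForm s) base) p)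

  universal-free : FreeAt universal base
  universal-free u w e =
    heap-injective (trans (sym (proj₁-act-universal u base)) (trans (cong proj₁ e) (proj₁-act-universal w base)))

module _ {n m : ℕ} (O : VoltageOperator n m) (X : Premaniplex n) where
  open VoltageOperator O

  walk-⋊ : ∀ cs x y →
           walk (X ⋊ O) cs (x , y) ≡ (act X (pathVoltage Y η cs y) x , walk (graph Y) cs y)
  walk-⋊ []       x y = refl
  walk-⋊ (c ∷ cs) x y = trans (walk-⋊ cs _ _)
    (cong (_, _) (sym (act-++ X (pathVoltage Y η cs (Premaniplex.step Y c y)) (η y c) x)))

  ⋊-connected⇒connected : Connected (X ⋊ O) → Connected (graph Y)
  ⋊-connected⇒connected (((x , y) , _) , path) = (y , y) , pathY
    where
    pathY : ∀ a b → Reachable (graph Y) a b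
    pathY a b with path (x , a) (x , b)
    ... | cs , p = cs , cong proj₂ (trans (sym (walk-⋊ cs x a)) p)

  ⋊-connected⇒voltageImageIsMon : ∀ {x₀} → FreeAt X x₀ → Connected (X ⋊ O) → ∀ y → VoltageImageIsMon O y
  ⋊-connected⇒voltageImageIsMon {x₀} free (_ , path) y g with path (x₀ , y) (act X g x₀ , y)
  ... | cs , p = cs , cong proj₂ p′ , free _ g (cong proj₁ p′)
    where
    p′ : (act X (pathVoltage Y η cs y) x₀ , walk (graph Y) cs y) ≡ (act X g x₀ , y)
    p′ = trans (sym (walk-⋊ cs x₀ y)) p

  ⋊-connected : Connected (graph Y) → ∀ {y₀} → VoltageImageIsMon O y₀ → Connected (graph X) → Connected (X ⋊ O)
  ⋊-connected (_ , pathY) {y₀} image ((x₀ , _) , pathX) = ((x₀ , y₀) , (x₀ , y₀)) , path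
    where
    intoFibre : ∀ x y → Σ (Premaniplex.V X) λ x′ → Reachable (X ⋊ O) (x , y) (x′ , y₀)
    intoFibre x y with pathY y y₀
    ... | cs , p = _ , cs , trans (walk-⋊ cs x y) (cong (act X (pathVoltage Y η cs y) x ,_) p)

    outOfFibre : ∀ x y → Σ (Premaniplex.V X) λ x′ → Reachable (X ⋊ O) (x′ , y₀) (x , y)
    outOfFibre x y with pathY y₀ y
    ... | cs , p = _ , cs , trans (walk-⋊ cs _ y₀) (cong₂ _,_ (act-winvʳ X (pathVoltage Y η cs y₀) x) p)

    alongFibre : ∀ x x′ → Reachable (X ⋊ O) (x , y₀) (x′ , y₀)
    alongFibre x x′ with pathX x x′
    ... | ds , reaches with image (reverse ds)
    ... | cs , closed , voltage = cs , (begin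
      walk (X ⋊ O) cs (x , y₀)                               ≡⟨ walk-⋊ cs x y₀ ⟩
      act X (pathVoltage Y η cs y₀) x , walk (graph Y) cs y₀ ≡⟨ cong₂ _,_ (act-cong X voltage x) closed ⟩
      act X (reverse ds) x , y₀                              ≡⟨ cong (_, y₀) (walk≡act-reverse X ds x) ⟨
      walk (graph X) ds x , y₀                               ≡⟨ cong (_, y₀) reaches ⟩
      x′ , y₀                                                ∎)
      where open ≡-Reasoning

    path : ∀ a b → Reachable (X ⋊ O) a b
    path (x , y) (x′ , y′) with intoFibre x y | outOfFibre x′ y′
    ... | x₁ , p₁ | x₂ , p₂ =
      Reachable-trans (X ⋊ O) p₁ (Reachable-trans (X ⋊ O) (alongFibre x₁ x₂) p₂)

corollary3p10 : ∀ {n m : ℕ} (O : VoltageOperator n m) →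
    PreservesConnectivity O ⇔
      (Connected (graph (VoltageOperator.Y O)) ×
       Σ (ColoredGraph.V (graph (VoltageOperator.Y O))) (λ y₀ → VoltageImageIsMon O y₀))
corollary3p10 O = mk⇔ necessary sufficient
  where
  open VoltageOperator O using (Y)

  Condition : Set
  Condition = Connected (graph Y) × Σ (Premaniplex.V Y) (VoltageImageIsMon O)

  necessary : PreservesConnectivity O → Condition
  necessary preserves = connectedY , y , ⋊-connected⇒voltageImageIsMon O universal universal-free connected y
    where
    connected : Connected (universal ⋊ O)
    connected = preserves universal universal-connected
    connectedY : Connected (graph Y)
    connectedY = ⋊-connected⇒connected O universal connected
    y : Premaniplex.V Y
    y = proj₁ (proj₁ connectedY)

  sufficient : Condition → PreservesConnectivity O
  sufficient (connectedY , _ , image) X = ⋊-connected O X connectedY image
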